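{- Let $D=(\mathcal P,\mathcal B)$ be an incidence structure with $|\mathcal P|=v$ and $|\mathcal B|=b$. Then there is an incidence-free pair $(X,Y)$ with $|X|\ge v-\gamma_e(D)$ and $|Y|\ge b-\gamma_e(D)$.
   Context: An incidence structure is a pair $D=(\mathcal P,\mathcal B)$ where $\mathcal B$ is a collection of subsets (blocks) of the point set $\mathcal P$; $P$ and $B$ are incident if $P\in B$. The incidence graph $I(D)$ is the bipartite graph on $\mathcal P\cup\mathcal B$ with $P\sim B$ iff $P\in B$. An edge dominating set of a graph is a set $\Gamma$ of edges such that every edge shares a vertex with some edge of $\Gamma$; $\gamma_e(D)$ is the minimum size of an edge dominating set of $I(D)$. A pair $(X,Y)$ with $X\subseteq\mathcal P$, $Y\subseteq\mathcal B$ is incidence-free if no point of $X$ is incident with a block of $Y$. -}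

module Defs where

open import Data.Nat using (ℕ; _≤_)
open import Data.Fin using (Fin)
open import Data.Fin.Subset using (Subset; _∈_; ∣_∣)
open import Data.Product using (_×_; _,_; ∃; ∃-syntax)
open import Data.Sum using (_⊎_)
open import Data.List using (List; length)
open import Data.List.Relation.Unary.All using (All)
open import Data.List.Relation.Unary.Any using (Any)
open import Relation.Binary.PropositionalEquality using (_≡_)
open import Relation.Nullary using (¬_)

-- An incidence structure with point set Fin v and b blocks (a family, so
-- repeated blocks are allowed); block j is a subset of the points.
IncStr : ℕ → ℕ → Set
IncStr v b = Fin b → Subset v

-- Edges of the incidence graph I(D): pairs (point, block) with point ∈ block.
Edge : ∀ {v b} → IncStr v b → Fin v × Fin b → Set
Edge D (p , j) = p ∈ D j

Adjacent : ∀ {v b} → Fin v × Fin b → Fin v × Fin b → Set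
Adjacent (p , j) (q , k) = (p ≡ q) ⊎ (j ≡ k)

IsEdgeDom : ∀ {v b} → IncStr v b → List (Fin v × Fin b) → Set
IsEdgeDom {v} {b} D Γ =
  All (Edge D) Γ ×
  (∀ (e : Fin v × Fin b) → Edge D e → Any (Adjacent e) Γ)

IsEdgeDomNumber : ∀ {v b} → IncStr v b → ℕ → Set
IsEdgeDomNumber {v} {b} D γ =
  (∃[ Γ ] (IsEdgeDom D Γ × length Γ ≡ γ)) ×
  (∀ (Γ : List (Fin v × Fin b)) → IsEdgeDom D Γ → γ ≤ length Γ)

IncidenceFree : ∀ {v b} → IncStr v b → Subset v → Subset b → Set
IncidenceFree {v} {b} D X Y = ∀ (p : Fin v) (j : Fin b) → p ∈ X → j ∈ Y → ¬ (p ∈ D j)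

-- Take a minimum edge dominating set Γ. Every incidence shares its point or
-- its block with an edge of Γ, so the points not covered by Γ and the blocks
-- not covered by Γ form an incidence-free pair. Γ covers at most |Γ| = γ_e(D)
-- points and at most γ_e(D) blocks, which gives the bounds.
module Submission where

open import Defs
open import Data.Nat using (ℕ; _+_; _≤_; suc; s≤s; z≤n)
open import Data.Nat.Properties
  using (≤-trans; ≤-reflexive; n≤1+n; +-suc; +-monoʳ-≤; m∸n+n≡m; module ≤-Reasoning)
open import Data.Fin using (Fin)
open import Data.Fin.Subset using (Subset; ∣_∣; _∈_; _∪_; ⁅_⁆; ⊥; ∁; inside; outside)
open import Data.Fin.Subset.Properties
  using (∣p∣≤n; ∣⊥∣≡0; ∣⁅x⁆∣≡1; ∣∁p∣≡n∸∣p∣; x∈⁅x⁆; x∈p∪q⁺; x∈∁p⇒x∉p)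
open import Data.Product using (_×_; _,_; proj₁; proj₂; ∃-syntax)
open import Data.Sum using (_⊎_; inj₁; inj₂; [_,_])
import Data.Sum as Sum
open import Data.List using (List; []; _∷_; length; map; foldr)
open import Data.List.Properties using (length-map)
open import Data.List.Relation.Unary.Any using (here; there)
open import Data.List.Relation.Unary.Any.Properties using (Any-⊎⁻; map⁺)
import Data.List.Membership.Propositional as List
open import Data.Vec using ([]; _∷_)
open import Relation.Binary.PropositionalEquality using (_≡_; refl; sym; cong)

∣p∪q∣≤∣p∣+∣q∣ : ∀ {n} (p q : Subset n) → ∣ p ∪ q ∣ ≤ ∣ p ∣ + ∣ q ∣
∣p∪q∣≤∣p∣+∣q∣ []            []            = z≤n
∣p∪q∣≤∣p∣+∣q∣ (inside  ∷ p) (inside  ∷ q) =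
  s≤s (≤-trans (∣p∪q∣≤∣p∣+∣q∣ p q) (+-monoʳ-≤ ∣ p ∣ (n≤1+n ∣ q ∣)))
∣p∪q∣≤∣p∣+∣q∣ (inside  ∷ p) (outside ∷ q) = s≤s (∣p∪q∣≤∣p∣+∣q∣ p q)
∣p∪q∣≤∣p∣+∣q∣ (outside ∷ p) (inside  ∷ q) =
  ≤-trans (s≤s (∣p∪q∣≤∣p∣+∣q∣ p q)) (≤-reflexive (sym (+-suc ∣ p ∣ ∣ q ∣)))
∣p∪q∣≤∣p∣+∣q∣ (outside ∷ p) (outside ∷ q) = ∣p∪q∣≤∣p∣+∣q∣ p q

∣∁p∣+∣p∣≡n : ∀ {n} (p : Subset n) → ∣ ∁ p ∣ + ∣ p ∣ ≡ n
∣∁p∣+∣p∣≡n p rewrite ∣∁p∣≡n∸∣p∣ p = m∸n+n≡m (∣p∣≤n p)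

fromList : ∀ {n} → List (Fin n) → Subset n
fromList = foldr (λ x p → ⁅ x ⁆ ∪ p) ⊥

∣fromList∣≤length : ∀ {n} (xs : List (Fin n)) → ∣ fromList xs ∣ ≤ length xs
∣fromList∣≤length {n} [] = ≤-reflexive (∣⊥∣≡0 n)
∣fromList∣≤length (x ∷ xs) = begin
  ∣ ⁅ x ⁆ ∪ fromList xs ∣        ≤⟨ ∣p∪q∣≤∣p∣+∣q∣ ⁅ x ⁆ (fromList xs) ⟩
  ∣ ⁅ x ⁆ ∣ + ∣ fromList xs ∣    ≡⟨ cong (_+ ∣ fromList xs ∣) (∣⁅x⁆∣≡1 x) ⟩
  suc ∣ fromList xs ∣            ≤⟨ s≤s (∣fromList∣≤length xs) ⟩
  suc (length xs)                ∎
  where open ≤-Reasoning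

∈fromList⁺ : ∀ {n} {x : Fin n} {xs : List (Fin n)} → x List.∈ xs → x ∈ fromList xs
∈fromList⁺ {x = x} (here refl) = x∈p∪q⁺ (inj₁ (x∈⁅x⁆ x))
∈fromList⁺ (there x∈xs)        = x∈p∪q⁺ (inj₂ (∈fromList⁺ x∈xs))

n≤∣∁fromList∣+length : ∀ {n} (xs : List (Fin n)) → n ≤ ∣ ∁ (fromList xs) ∣ + length xs
n≤∣∁fromList∣+length {n} xs = begin
  n                                       ≡⟨ sym (∣∁p∣+∣p∣≡n (fromList xs)) ⟩
  ∣ ∁ (fromList xs) ∣ + ∣ fromList xs ∣   ≤⟨ +-monoʳ-≤ _ (∣fromList∣≤length xs) ⟩
  ∣ ∁ (fromList xs) ∣ + length xs         ∎
  where open ≤-Reasoning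

n≤∣∁fromList-map∣+length : ∀ {a} {A : Set a} {n} (f : A → Fin n) (xs : List A) →
                           n ≤ ∣ ∁ (fromList (map f xs)) ∣ + length xs
n≤∣∁fromList-map∣+length {n = n} f xs = begin
  n                                               ≤⟨ n≤∣∁fromList∣+length (map f xs) ⟩
  ∣ ∁ (fromList (map f xs)) ∣ + length (map f xs) ≡⟨ cong (∣ ∁ (fromList (map f xs)) ∣ +_) (length-map f xs) ⟩
  ∣ ∁ (fromList (map f xs)) ∣ + length xs         ∎
  where open ≤-Reasoning

module _ {v b : ℕ} (Γ : List (Fin v × Fin b)) where

  uncoveredPoints : Subset v
  uncoveredPoints = ∁ (fromList (map proj₁ Γ))

  uncoveredBlocks : Subset b
  uncoveredBlocks = ∁ (fromList (map proj₂ Γ))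

  -- Adjacent (p , j) e unfolds (by η for pairs) to p ≡ proj₁ e ⊎ j ≡ proj₂ e.
  edge-covered : ∀ {D : IncStr v b} → IsEdgeDom D Γ → ∀ {p j} → Edge D (p , j) →
                 p List.∈ map proj₁ Γ ⊎ j List.∈ map proj₂ Γ
  edge-covered (_ , dom) {p} {j} p∈Dj = Sum.map map⁺ map⁺ (Any-⊎⁻ (dom (p , j) p∈Dj))

  uncovered-incidenceFree : ∀ {D : IncStr v b} → IsEdgeDom D Γ → IncidenceFree D uncoveredPoints uncoveredBlocks
  uncovered-incidenceFree Γ-dom p j p∈X j∈Y p∈Dj =
    [ (λ p∈Γ → x∈∁p⇒x∉p p∈X (∈fromList⁺ p∈Γ))
    , (λ j∈Γ → x∈∁p⇒x∉p j∈Y (∈fromList⁺ j∈Γ))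
    ] (edge-covered Γ-dom p∈Dj)

lemma2p1 : ∀ (v b : ℕ) (D : IncStr v b) (γ : ℕ) → IsEdgeDomNumber D γ →
    ∃[ X ] ∃[ Y ] (IncidenceFree D X Y × v ≤ ∣ X ∣ + γ × b ≤ ∣ Y ∣ + γ)
lemma2p1 v b D γ ((Γ , Γ-dom , refl) , _) =
    uncoveredPoints Γ
  , uncoveredBlocks Γ
  , uncovered-incidenceFree Γ Γ-dom
  , n≤∣∁fromList-map∣+length proj₁ Γ
  , n≤∣∁fromList-map∣+length proj₂ Γ
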